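{- Let $\mathbf t=t_0t_1t_2\cdots=01101001\cdots$ be the Thue--Morse word, the fixed point of $0\mapsto01$, $1\mapsto10$. For $i\ge0$ and $m,n\ge1$ let $A(i,m,n)=(t_{i+k+\ell})_{0\le k<m,0\le\ell<n}$ and let $|A(i,m,n)|_1$ be the number of entries equal to $1$. Then: (a) every such rectangle satisfies $\big|2|A(i,m,n)|_1-mn\big|\le4$; (b) if there is $i$ with $2|A(i,m,n)|_1-mn=c$, then there is $j$ with $2|A(j,m,n)|_1-mn=-c$; (c) for all $m,n\ge1$, the balance of the $m\times n$ rectangles is $1$, $2$, $3$, or $4$.
   Context: The balance of the $m\times n$ rectangles is $\max_{i,j\ge0}\big||A(i,m,n)|_1-|A(j,m,n)|_1\big|$ (for a binary word this equals the corresponding maximum for the letter $0$). -}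

module Defs where

open import Data.Nat using (ℕ; zero; suc; _+_; _*_; _/_; _%_; ∣_-_∣; _≡ᵇ_)
open import Data.Bool using (Bool; true; false; if_then_else_; not)
open import Data.Integer using (ℤ; +_; _-_)
open import Data.Product using (_×_; ∃-syntax)
open import Relation.Binary.PropositionalEquality using (_≡_)

-- Thue–Morse word t : ℕ → ℕ with values in {0,1}, fixed point of
-- 0 ↦ 01, 1 ↦ 10, i.e. t 0 = 0, t (2k) = t k, t (2k+1) = 1 - t k.
-- Computed with fuel (fuel = n is always enough, as n / 2 < n for n ≥ 1,
-- and the recursion on 0 returns 0).
tmBit : ℕ → ℕ → Bool
tmBit zero    _ = false
tmBit (suc f) n =
  if n % 2 ≡ᵇ 1 then not (tmBit f (n / 2)) else tmBit f (n / 2)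

t : ℕ → ℕ
t n = if tmBit n n then 1 else 0

Σ< : ℕ → (ℕ → ℕ) → ℕ
Σ< zero    f = 0
Σ< (suc m) f = Σ< m f + f m

ones : ℕ → ℕ → ℕ → ℕ
ones i m n = Σ< m (λ k → Σ< n (λ ℓ → t (i + k + ℓ)))

disc : ℕ → ℕ → ℕ → ℤ
disc i m n = + (2 * ones i m n) - + (m * n)

IsBalance : ℕ → ℕ → ℕ → Set
IsBalance m n b =
  (∀ i j → ∣ ones i m n - ones j m n ∣ Data.Nat.≤ b)
  × (∃[ i ] ∃[ j ] ∣ ones i m n - ones j m n ∣ ≡ b)

{-# OPTIONS --safe #-}
-- Write ε = 2t − 1 ∈ {±1} for the Thue–Morse word and S₁, S₂ for its first and second
-- summatory functions.  Summing ε over a rectangle makes the discrepancy a second difference,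
--   2|A(i,m,n)|₁ − mn = S₂(i+n+m) − S₂(i+n) − S₂(i+m) + S₂(i),
-- and the substitution 0 ↦ 01, 1 ↦ 10 gives S₁(2k) = 0, S₁(2k+1) = ε(k) and
-- S₂(2k) = S₂(2k+1) = S₁(k).  Hence |S₂| ≤ 1, which is (a).  Adding 2^K to the start of a
-- rectangle inside [0, 2^K) complements every entry, since t(2^K + x) = 1 − t(x); this is (b).
--
-- For (c), t(q 2^K + y) for y < 2^(K+1) depends only on t(q) and t(q+1), and each of the four
-- pairs occurs for some q < 6, so every count |A(i,m,n)|₁ is attained at some i < 6·2^(m+n):
-- maximum and minimum exist, and by (a) they differ by at most 4.  They differ at all: if m and
-- n are odd the discrepancy is odd; otherwise, by the halving identities for S₂, at suitable
-- starts it equals a step disc(k+1) − disc(k) of the ⌈m/2⌉ × ⌈n/2⌉ discrepancy, which by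
-- induction is nonzero somewhere, hence by (b) not constant, hence has a nonzero step.
module Submission where

open import Defs
open import Data.Nat using (ℕ; zero; suc; z<s; s≤s; _*_; _^_; _<_; _≤_; _≥_)
open import Data.Nat.Properties using (+-mono-≤-<; m^n>0; <-≤-trans; m≤m+n)
open import Data.Integer using (ℤ; ∣_∣; -_)
open import Data.Product using (_×_; ∃-syntax; _,_)
open import Data.Sum using (_⊎_; inj₁; inj₂)
open import Data.Empty using (⊥-elim)
open import Relation.Binary.Definitions using (DecidableEquality)
open import Relation.Binary.PropositionalEquality using (_≡_; _≢_; refl; trans; sym)
open import Relation.Nullary using (yes; no)

data EvenOdd : ℕ → Set where
  even : ∀ k → EvenOdd (k * 2)
  odd  : ∀ k → EvenOdd (suc (k * 2))

evenOdd : ∀ n → EvenOdd n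
evenOdd zero    = even 0
evenOdd (suc n) with evenOdd n
... | even k = odd k
... | odd  k = even (suc k)

n<2^n : ∀ n → n < 2 ^ n
n<2^n zero    = z<s
n<2^n (suc n) = +-mono-≤-< (m^n>0 2 n) (<-≤-trans (n<2^n n) (m≤m+n _ 0))

module _ {a} {A : Set a} (_≟_ : DecidableEquality A) (f : ℕ → A) where

  ≢f0⇒∃-step : ∀ i → f i ≢ f 0 → ∃[ k ] f (suc k) ≢ f k
  ≢f0⇒∃-step zero    fi≢f0 = ⊥-elim (fi≢f0 refl)
  ≢f0⇒∃-step (suc i) fi≢f0 with f (suc i) ≟ f i
  ... | no  step = i , step
  ... | yes same = ≢f0⇒∃-step i (λ fi≡f0 → fi≢f0 (trans same fi≡f0))

  ≢⇒∃-step : ∀ i j → f i ≢ f j → ∃[ k ] f (suc k) ≢ f k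
  ≢⇒∃-step i j fi≢fj with f i ≟ f 0
  ... | no  fi≢f0 = ≢f0⇒∃-step i fi≢f0
  ... | yes fi≡f0 = ≢f0⇒∃-step j (λ fj≡f0 → fi≢fj (trans fi≡f0 (sym fj≡f0)))

one-to-four : ∀ {P : ℕ → Set} {β} → 1 ≤ β → β ≤ 4 → P β → P 1 ⊎ P 2 ⊎ P 3 ⊎ P 4
one-to-four {β = 1} _ _ p = inj₁ p
one-to-four {β = 2} _ _ p = inj₂ (inj₁ p)
one-to-four {β = 3} _ _ p = inj₂ (inj₂ (inj₁ p))
one-to-four {β = 4} _ _ p = inj₂ (inj₂ (inj₂ p))
one-to-four {β = suc (suc (suc (suc (suc _))))} _ (s≤s (s≤s (s≤s (s≤s ())))) _

module ThueMorse where

  open import Data.Nat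
  open import Data.Nat.Properties
  open import Data.Nat.DivMod
  open import Data.Nat.Tactic.RingSolver using (solve-∀)
  open import Data.Bool using (Bool; false; if_then_else_; not; _xor_)
  open import Data.Bool.Properties using (xor-identityʳ; not-distribʳ-xor)
  open import Relation.Binary.PropositionalEquality
  open ≡-Reasoning

  tm : ℕ → Bool
  tm n = tmBit n n

  private
    [1+n]/2≤n : ∀ n → suc n / 2 ≤ n
    [1+n]/2≤n n = ≤-pred (m/n<m (suc n) 2 (s≤s (s≤s z≤n)))

  tmBit-zero : ∀ f → tmBit f 0 ≡ false
  tmBit-zero zero    = refl
  tmBit-zero (suc f) = tmBit-zero f

  tmBit-fuel : ∀ {f g n} → n ≤ f → n ≤ g → tmBit f n ≡ tmBit g n
  tmBit-fuel {f} {g} {zero} _ _ = trans (tmBit-zero f) (sym (tmBit-zero g))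
  tmBit-fuel {suc f} {suc g} {suc n} (s≤s n≤f) (s≤s n≤g) =
    cong (λ b → if suc n % 2 ≡ᵇ 1 then not b else b)
         (tmBit-fuel (≤-trans ([1+n]/2≤n n) n≤f) (≤-trans ([1+n]/2≤n n) n≤g))

  tm-step : ∀ n → tm n ≡ (if n % 2 ≡ᵇ 1 then not (tm (n / 2)) else tm (n / 2))
  tm-step zero    = refl
  tm-step (suc n) =
    cong (λ b → if suc n % 2 ≡ᵇ 1 then not b else b) (tmBit-fuel ([1+n]/2≤n n) ≤-refl)

  private
    tm-step′ : ∀ {n r h} → n % 2 ≡ r → n / 2 ≡ h → tm n ≡ (if r ≡ᵇ 1 then not (tm h) else tm h)
    tm-step′ {n} n%2≡r n/2≡h =
      trans (tm-step n) (cong₂ (λ r h → if r ≡ᵇ 1 then not (tm h) else tm h) n%2≡r n/2≡h)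

  tm-double : ∀ k → tm (k * 2) ≡ tm k
  tm-double k = tm-step′ {k * 2} (m*n%n≡0 k 2) (m*n/n≡m k 2)

  tm-double+1 : ∀ k → tm (suc (k * 2)) ≡ not (tm k)
  tm-double+1 k = tm-step′ {suc (k * 2)} ([m+kn]%n≡m%n 1 k 2) [1+k*2]/2≡k
    where
    [1+k*2]/2≡k : suc (k * 2) / 2 ≡ k
    [1+k*2]/2≡k =
      trans (+-distrib-/ 1 (k * 2) (subst (λ r → 1 + r < 2) (sym (m*n%n≡0 k 2)) ≤-refl))
            (m*n/n≡m k 2)

  private
    shift-double : ∀ q a k → q * (2 * a) + k * 2 ≡ (q * a + k) * 2
    shift-double = solve-∀

    shift-double+1 : ∀ q a k → q * (2 * a) + suc (k * 2) ≡ suc ((q * a + k) * 2)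
    shift-double+1 = solve-∀

    halve-< : ∀ {k a} → k * 2 < 2 * a → k < a
    halve-< {k} {a} k*2<2*a = *-cancelˡ-< 2 k a (subst (_< 2 * a) (*-comm k 2) k*2<2*a)

  tm-concat : ∀ K q r → r < 2 ^ K → tm (q * 2 ^ K + r) ≡ tm q xor tm r
  tm-concat zero q zero _ = begin
    tm (q * 1 + 0)  ≡⟨ cong tm (trans (+-identityʳ _) (*-identityʳ q)) ⟩
    tm q            ≡⟨ xor-identityʳ (tm q) ⟨
    tm q xor false  ∎
  tm-concat zero q (suc r) (s≤s ())
  tm-concat (suc K) q r r< with evenOdd r
  ... | even k = begin
    tm (q * (2 * 2 ^ K) + k * 2)  ≡⟨ cong tm (shift-double q (2 ^ K) k) ⟩
    tm ((q * 2 ^ K + k) * 2)      ≡⟨ tm-double (q * 2 ^ K + k) ⟩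
    tm (q * 2 ^ K + k)            ≡⟨ tm-concat K q k (halve-< r<) ⟩
    tm q xor tm k                 ≡⟨ cong (tm q xor_) (tm-double k) ⟨
    tm q xor tm (k * 2)           ∎
  ... | odd k = begin
    tm (q * (2 * 2 ^ K) + suc (k * 2))  ≡⟨ cong tm (shift-double+1 q (2 ^ K) k) ⟩
    tm (suc ((q * 2 ^ K + k) * 2))      ≡⟨ tm-double+1 (q * 2 ^ K + k) ⟩
    not (tm (q * 2 ^ K + k))            ≡⟨ cong not (tm-concat K q k (halve-< (<-trans (n<1+n _) r<))) ⟩
    not (tm q xor tm k)                 ≡⟨ not-distribʳ-xor (tm q) (tm k) ⟩
    tm q xor not (tm k)                 ≡⟨ cong (tm q xor_) (tm-double+1 k) ⟨
    tm q xor tm (suc (k * 2))           ∎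

  tm-flip : ∀ {K x} → x < 2 ^ K → tm (2 ^ K + x) ≡ not (tm x)
  tm-flip {K} {x} x< =
    trans (cong (λ a → tm (a + x)) (sym (*-identityˡ (2 ^ K)))) (tm-concat K 1 x x<)

module Discrepancy where

  open ThueMorse
  open import Data.Nat.Base as ℕ using (z≤n)
  import Data.Nat.Properties as ℕ
  import Data.Nat.Induction as ℕ
  import Data.Nat.Tactic.RingSolver as ℕ-Solver
  open import Data.Integer.Base using (+_; +[1+_]; -[1+_]; 0ℤ; 1ℤ; -1ℤ; _+_; _-_)
  open import Data.Integer.Properties
    using ( _≟_; +-identityˡ; +-identityʳ; +-inverseʳ; pos-+; neg-distrib-+
          ; ∣i-j∣≤∣i∣+∣j∣; i-j≡0⇒i≡j; +-injective)
  open import Data.Integer.Tactic.RingSolver using (solve-∀)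
  open import Data.Bool using (true; false; if_then_else_; not)
  open import Data.List using (_∷_; [])
  open import Function using (_∘_)
  open import Induction.WellFounded using (Acc; acc)
  open import Relation.Binary.PropositionalEquality
  open ≡-Reasoning

  ε : ℕ → ℤ
  ε x = if tm x then 1ℤ else -1ℤ

  Σℤ< : ℕ → (ℕ → ℤ) → ℤ
  Σℤ< zero    f = 0ℤ
  Σℤ< (suc m) f = Σℤ< m f + f m

  S₁ : ℕ → ℤ
  S₁ j = Σℤ< j ε

  S₂ : ℕ → ℤ
  S₂ j = Σℤ< j S₁

  box : (ℕ → ℤ) → ℕ → ℕ → ℕ → ℤ
  box f i m n = (f (i ℕ.+ n ℕ.+ m) - f (i ℕ.+ n)) - (f (i ℕ.+ m) - f i)

  Σℤ<-cong : ∀ m {f g : ℕ → ℤ} → (∀ {k} → k < m → f k ≡ g k) → Σℤ< m f ≡ Σℤ< m g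
  Σℤ<-cong zero    _   = refl
  Σℤ<-cong (suc m) f≡g = cong₂ _+_ (Σℤ<-cong m (f≡g ∘ ℕ.m<n⇒m<1+n)) (f≡g ℕ.≤-refl)

  Σℤ<-neg : ∀ m f → Σℤ< m (λ k → - f k) ≡ - Σℤ< m f
  Σℤ<-neg zero    f = refl
  Σℤ<-neg (suc m) f =
    trans (cong (_+ - f m) (Σℤ<-neg m f)) (sym (neg-distrib-+ (Σℤ< m f) (f m)))

  Σℤ<-sub : ∀ m f g → Σℤ< m (λ k → f k - g k) ≡ Σℤ< m f - Σℤ< m g
  Σℤ<-sub zero    f g = refl
  Σℤ<-sub (suc m) f g =
    trans (cong (_+ (f m - g m)) (Σℤ<-sub m f g)) (interchange (Σℤ< m f) (Σℤ< m g) (f m) (g m))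
    where
    interchange : ∀ a b c d → (a - b) + (c - d) ≡ (a + c) - (b + d)
    interchange = solve-∀

  Σℤ<-shift : ∀ s n f → Σℤ< n (λ l → f (s ℕ.+ l)) ≡ Σℤ< (s ℕ.+ n) f - Σℤ< s f
  Σℤ<-shift s zero f = begin
    0ℤ                         ≡⟨ +-inverseʳ (Σℤ< s f) ⟨
    Σℤ< s f - Σℤ< s f          ≡⟨ cong (λ x → Σℤ< x f - Σℤ< s f) (ℕ.+-identityʳ s) ⟨
    Σℤ< (s ℕ.+ 0) f - Σℤ< s f  ∎
  Σℤ<-shift s (suc n) f = begin
    Σℤ< n (λ l → f (s ℕ.+ l)) + f (s ℕ.+ n)    ≡⟨ cong (_+ f (s ℕ.+ n)) (Σℤ<-shift s n f) ⟩
    (Σℤ< (s ℕ.+ n) f - Σℤ< s f) + f (s ℕ.+ n)  ≡⟨ swap (Σℤ< (s ℕ.+ n) f) (Σℤ< s f) (f (s ℕ.+ n)) ⟩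
    Σℤ< (suc (s ℕ.+ n)) f - Σℤ< s f            ≡⟨ cong (λ x → Σℤ< x f - Σℤ< s f) (ℕ.+-suc s n) ⟨
    Σℤ< (s ℕ.+ suc n) f - Σℤ< s f              ∎
    where
    swap : ∀ a b c → (a - b) + c ≡ (a + c) - b
    swap = solve-∀

  Σ<-excess : ∀ m (g : ℕ → ℕ) c →
              + (2 ℕ.* Σ< m g) - + (m ℕ.* c) ≡ Σℤ< m (λ k → + (2 ℕ.* g k) - + c)
  Σ<-excess zero    g c = refl
  Σ<-excess (suc m) g c = begin
    + (2 ℕ.* (Σ< m g ℕ.+ g m)) - + (c ℕ.+ m ℕ.* c)
      ≡⟨ cong (λ x → + x - + (c ℕ.+ m ℕ.* c)) (ℕ.*-distribˡ-+ 2 (Σ< m g) (g m)) ⟩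
    + (2 ℕ.* Σ< m g ℕ.+ 2 ℕ.* g m) - + (c ℕ.+ m ℕ.* c)
      ≡⟨ cong₂ _-_ (pos-+ (2 ℕ.* Σ< m g) (2 ℕ.* g m)) (pos-+ c (m ℕ.* c)) ⟩
    (+ (2 ℕ.* Σ< m g) + + (2 ℕ.* g m)) - (+ c + + (m ℕ.* c))
      ≡⟨ regroup (+ (2 ℕ.* Σ< m g)) (+ (2 ℕ.* g m)) (+ c) (+ (m ℕ.* c)) ⟩
    (+ (2 ℕ.* Σ< m g) - + (m ℕ.* c)) + (+ (2 ℕ.* g m) - + c)
      ≡⟨ cong (_+ (+ (2 ℕ.* g m) - + c)) (Σ<-excess m g c) ⟩
    Σℤ< m (λ k → + (2 ℕ.* g k) - + c) + (+ (2 ℕ.* g m) - + c)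
      ∎
    where
    regroup : ∀ a b c d → (a + b) - (c + d) ≡ (a - d) + (b - c)
    regroup = solve-∀

  2t-1≡ε : ∀ x → + (2 ℕ.* t x) - + 1 ≡ ε x
  2t-1≡ε x with tm x
  ... | true  = refl
  ... | false = refl

  disc≡Σε : ∀ i m n → disc i m n ≡ Σℤ< m (λ k → Σℤ< n (λ l → ε (i ℕ.+ k ℕ.+ l)))
  disc≡Σε i m n = trans (Σ<-excess m _ n) (Σℤ<-cong m λ {k} _ → row k)
    where
    row : ∀ k → + (2 ℕ.* Σ< n (λ l → t (i ℕ.+ k ℕ.+ l))) - + n ≡ Σℤ< n (λ l → ε (i ℕ.+ k ℕ.+ l))
    row k = begin
      + (2 ℕ.* Σ< n (λ l → t (i ℕ.+ k ℕ.+ l))) - + n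
        ≡⟨ cong (λ c → + (2 ℕ.* Σ< n (λ l → t (i ℕ.+ k ℕ.+ l))) - + c) (ℕ.*-identityʳ n) ⟨
      + (2 ℕ.* Σ< n (λ l → t (i ℕ.+ k ℕ.+ l))) - + (n ℕ.* 1)
        ≡⟨ Σ<-excess n _ 1 ⟩
      Σℤ< n (λ l → + (2 ℕ.* t (i ℕ.+ k ℕ.+ l)) - + 1)
        ≡⟨ Σℤ<-cong n (λ {l} _ → 2t-1≡ε (i ℕ.+ k ℕ.+ l)) ⟩
      Σℤ< n (λ l → ε (i ℕ.+ k ℕ.+ l))
        ∎

  disc≡box : ∀ i m n → disc i m n ≡ box S₂ i m n
  disc≡box i m n = begin
    disc i m n
      ≡⟨ disc≡Σε i m n ⟩
    Σℤ< m (λ k → Σℤ< n (λ l → ε (i ℕ.+ k ℕ.+ l)))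
      ≡⟨ Σℤ<-cong m (λ {k} _ → Σℤ<-shift (i ℕ.+ k) n ε) ⟩
    Σℤ< m (λ k → S₁ (i ℕ.+ k ℕ.+ n) - S₁ (i ℕ.+ k))
      ≡⟨ Σℤ<-sub m _ _ ⟩
    Σℤ< m (λ k → S₁ (i ℕ.+ k ℕ.+ n)) - Σℤ< m (λ k → S₁ (i ℕ.+ k))
      ≡⟨ cong (_- Σℤ< m (λ k → S₁ (i ℕ.+ k))) (Σℤ<-cong m (λ {k} _ → cong S₁ (swap k))) ⟩
    Σℤ< m (λ k → S₁ (i ℕ.+ n ℕ.+ k)) - Σℤ< m (λ k → S₁ (i ℕ.+ k))
      ≡⟨ cong₂ _-_ (Σℤ<-shift (i ℕ.+ n) m S₁) (Σℤ<-shift i m S₁) ⟩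
    box S₂ i m n
      ∎
    where
    swap : ∀ k → i ℕ.+ k ℕ.+ n ≡ i ℕ.+ n ℕ.+ k
    swap k = ℕ-Solver.solve (i ∷ k ∷ n ∷ [])

  ε-not : ∀ x y → tm y ≡ not (tm x) → ε y ≡ - ε x
  ε-not x y tmy≡¬tmx = trans (cong (λ b → if b then 1ℤ else -1ℤ) tmy≡¬tmx) (sign-not (tm x))
    where
    sign-not : ∀ b → (if not b then 1ℤ else -1ℤ) ≡ - (if b then 1ℤ else -1ℤ)
    sign-not true  = refl
    sign-not false = refl

  ε-double : ∀ k → ε (k ℕ.* 2) ≡ ε k
  ε-double k = cong (λ b → if b then 1ℤ else -1ℤ) (tm-double k)

  ε-double+1 : ∀ k → ε (suc (k ℕ.* 2)) ≡ - ε k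
  ε-double+1 k = ε-not k (suc (k ℕ.* 2)) (tm-double+1 k)

  ε-flip : ∀ {K x} → x < 2 ^ K → ε (2 ^ K ℕ.+ x) ≡ - ε x
  ε-flip {K} {x} x< = ε-not x (2 ^ K ℕ.+ x) (tm-flip {K} x<)

  ∣ε∣≡1 : ∀ x → ∣ ε x ∣ ≡ 1
  ∣ε∣≡1 x with tm x
  ... | true  = refl
  ... | false = refl

  S₁-double : ∀ k → S₁ (k ℕ.* 2) ≡ 0ℤ
  S₁-double zero    = refl
  S₁-double (suc k) = begin
    S₁ (k ℕ.* 2) + ε (k ℕ.* 2) + ε (suc (k ℕ.* 2))
      ≡⟨ cong₂ (λ s e → s + e + ε (suc (k ℕ.* 2))) (S₁-double k) (ε-double k) ⟩
    0ℤ + ε k + ε (suc (k ℕ.* 2))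
      ≡⟨ cong₂ _+_ (+-identityˡ (ε k)) (ε-double+1 k) ⟩
    ε k - ε k
      ≡⟨ +-inverseʳ (ε k) ⟩
    0ℤ
      ∎

  S₁-double+1 : ∀ k → S₁ (suc (k ℕ.* 2)) ≡ ε k
  S₁-double+1 k = trans (cong₂ _+_ (S₁-double k) (ε-double k)) (+-identityˡ (ε k))

  S₂-double : ∀ k → S₂ (k ℕ.* 2) ≡ S₁ k
  S₂-double+1 : ∀ k → S₂ (suc (k ℕ.* 2)) ≡ S₁ k

  S₂-double zero    = refl
  S₂-double (suc k) = cong₂ _+_ (S₂-double+1 k) (S₁-double+1 k)

  S₂-double+1 k = trans (cong₂ _+_ (S₂-double k) (S₁-double k)) (+-identityʳ (S₁ k))

  ∣S₁∣≤1 : ∀ j → ∣ S₁ j ∣ ℕ.≤ 1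
  ∣S₁∣≤1 j with evenOdd j
  ... | even k rewrite S₁-double k   = z≤n
  ... | odd  k rewrite S₁-double+1 k = ℕ.≤-reflexive (∣ε∣≡1 k)

  ∣S₂∣≤1 : ∀ j → ∣ S₂ j ∣ ℕ.≤ 1
  ∣S₂∣≤1 j with evenOdd j
  ... | even k rewrite S₂-double k   = ∣S₁∣≤1 k
  ... | odd  k rewrite S₂-double+1 k = ∣S₁∣≤1 k

  ∣box∣≤4 : ∀ f → (∀ x → ∣ f x ∣ ℕ.≤ 1) → ∀ i m n → ∣ box f i m n ∣ ℕ.≤ 4
  ∣box∣≤4 f ∣f∣≤1 i m n =
    ℕ.≤-trans (∣i-j∣≤∣i∣+∣j∣ (f (i ℕ.+ n ℕ.+ m) - f (i ℕ.+ n)) (f (i ℕ.+ m) - f i))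
              (ℕ.+-mono-≤ (∣f-f∣≤2 (i ℕ.+ n ℕ.+ m) (i ℕ.+ n)) (∣f-f∣≤2 (i ℕ.+ m) i))
    where
    ∣f-f∣≤2 : ∀ x y → ∣ f x - f y ∣ ℕ.≤ 2
    ∣f-f∣≤2 x y = ℕ.≤-trans (∣i-j∣≤∣i∣+∣j∣ (f x) (f y)) (ℕ.+-mono-≤ (∣f∣≤1 x) (∣f∣≤1 y))

  ∣disc∣≤4 : ∀ i m n → ∣ disc i m n ∣ ℕ.≤ 4
  ∣disc∣≤4 i m n = subst (λ d → ∣ d ∣ ℕ.≤ 4) (sym (disc≡box i m n)) (∣box∣≤4 S₂ ∣S₂∣≤1 i m n)

  disc-flip : ∀ i m n → disc (2 ^ (i ℕ.+ m ℕ.+ n) ℕ.+ i) m n ≡ - disc i m n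
  disc-flip i m n = begin
    disc (a ℕ.+ i) m n
      ≡⟨ disc≡Σε (a ℕ.+ i) m n ⟩
    Σℤ< m (λ k → Σℤ< n (λ l → ε (a ℕ.+ i ℕ.+ k ℕ.+ l)))
      ≡⟨ Σℤ<-cong m (λ k<m → Σℤ<-cong n (λ l<n → flip k<m l<n)) ⟩
    Σℤ< m (λ k → Σℤ< n (λ l → - ε (i ℕ.+ k ℕ.+ l)))
      ≡⟨ Σℤ<-cong m (λ _ → Σℤ<-neg n _) ⟩
    Σℤ< m (λ k → - Σℤ< n (λ l → ε (i ℕ.+ k ℕ.+ l)))
      ≡⟨ Σℤ<-neg m _ ⟩
    - Σℤ< m (λ k → Σℤ< n (λ l → ε (i ℕ.+ k ℕ.+ l)))
      ≡⟨ cong -_ (disc≡Σε i m n) ⟨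
    - disc i m n
      ∎
    where
    a = 2 ^ (i ℕ.+ m ℕ.+ n)
    reassoc : ∀ a i k l → a ℕ.+ i ℕ.+ k ℕ.+ l ≡ a ℕ.+ (i ℕ.+ k ℕ.+ l)
    reassoc = ℕ-Solver.solve-∀
    flip : ∀ {k l} → k < m → l < n → ε (a ℕ.+ i ℕ.+ k ℕ.+ l) ≡ - ε (i ℕ.+ k ℕ.+ l)
    flip {k} {l} k<m l<n =
      trans (cong ε (reassoc a i k l))
            (ε-flip {i ℕ.+ m ℕ.+ n}
                    (ℕ.<-trans (ℕ.+-mono-< (ℕ.+-monoʳ-< i k<m) l<n) (n<2^n (i ℕ.+ m ℕ.+ n))))

  ∃disc-neg : ∀ m n c → ∃[ i ] disc i m n ≡ c → ∃[ j ] disc j m n ≡ - c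
  ∃disc-neg m n c (i , disc≡c) =
    2 ^ (i ℕ.+ m ℕ.+ n) ℕ.+ i , trans (disc-flip i m n) (cong -_ disc≡c)

  i≡-i⇒i≡0 : ∀ {i} → i ≡ - i → i ≡ 0ℤ
  i≡-i⇒i≡0 {+ zero}    _ = refl
  i≡-i⇒i≡0 {+[1+ _ ]}  ()
  i≡-i⇒i≡0 { -[1+ _ ]} ()

  disc-varies : ∀ i m n → disc i m n ≢ 0ℤ → ∃[ j ] disc j m n ≢ disc i m n
  disc-varies i m n disc≢0 =
    2 ^ (i ℕ.+ m ℕ.+ n) ℕ.+ i , λ eq → disc≢0 (i≡-i⇒i≡0 (trans (sym eq) (disc-flip i m n)))

  box-comm : ∀ f i m n → box f i m n ≡ box f i n m
  box-comm f i m n = begin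
    (f (i ℕ.+ n ℕ.+ m) - f (i ℕ.+ n)) - (f (i ℕ.+ m) - f i)
      ≡⟨ cong (λ x → (f x - f (i ℕ.+ n)) - (f (i ℕ.+ m) - f i)) (ℕ-Solver.solve (i ∷ n ∷ m ∷ [])) ⟩
    (f (i ℕ.+ m ℕ.+ n) - f (i ℕ.+ n)) - (f (i ℕ.+ m) - f i)
      ≡⟨ swap (f (i ℕ.+ m ℕ.+ n)) (f (i ℕ.+ n)) (f (i ℕ.+ m)) (f i) ⟩
    (f (i ℕ.+ m ℕ.+ n) - f (i ℕ.+ m)) - (f (i ℕ.+ n) - f i)
      ∎
    where
    swap : ∀ a b c d → (a - b) - (c - d) ≡ (a - c) - (b - d)
    swap = solve-∀

  box-Σ-suc : ∀ f i m n →
              box (λ j → Σℤ< j f) (suc i) m n ≡ box (λ j → Σℤ< j f) i m n + box f i m n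
  box-Σ-suc f i m n = regroup
    (Σℤ< (i ℕ.+ n ℕ.+ m) f) (Σℤ< (i ℕ.+ n) f) (Σℤ< (i ℕ.+ m) f) (Σℤ< i f)
    (f (i ℕ.+ n ℕ.+ m)) (f (i ℕ.+ n)) (f (i ℕ.+ m)) (f i)
    where
    regroup : ∀ a b c d a′ b′ c′ d′ →
              ((a + a′) - (b + b′)) - ((c + c′) - (d + d′))
                ≡ ((a - b) - (c - d)) + ((a′ - b′) - (c′ - d′))
    regroup = solve-∀

  disc-step : ∀ k m n → disc (suc k) m n - disc k m n ≡ box S₁ k m n
  disc-step k m n = begin
    disc (suc k) m n - disc k m n               ≡⟨ cong₂ _-_ (disc≡box (suc k) m n) (disc≡box k m n) ⟩
    box S₂ (suc k) m n - box S₂ k m n           ≡⟨ cong (_- box S₂ k m n) (box-Σ-suc S₁ k m n) ⟩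
    box S₂ k m n + box S₁ k m n - box S₂ k m n  ≡⟨ cancel (box S₂ k m n) (box S₁ k m n) ⟩
    box S₁ k m n                                ∎
    where
    cancel : ∀ a b → a + b - a ≡ b
    cancel = solve-∀

  private
    S₂-at-double : ∀ {x} y → x ≡ y ℕ.* 2 → S₂ x ≡ S₁ y
    S₂-at-double y refl = S₂-double y

    S₂-at-double+1 : ∀ {x} y → x ≡ suc (y ℕ.* 2) → S₂ x ≡ S₁ y
    S₂-at-double+1 y refl = S₂-double+1 y

  disc-even-even : ∀ k a b → disc (k ℕ.* 2) (a ℕ.* 2) (b ℕ.* 2) ≡ box S₁ k a b
  disc-even-even k a b = trans (disc≡box (k ℕ.* 2) (a ℕ.* 2) (b ℕ.* 2)) (cong₂ _-_
    (cong₂ _-_ (S₂-at-double (k ℕ.+ b ℕ.+ a) (e+e+e k b a)) (S₂-at-double (k ℕ.+ b) (e+e k b)))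
    (cong₂ _-_ (S₂-at-double (k ℕ.+ a) (e+e k a)) (S₂-double k)))
    where
    e+e : ∀ x y → x ℕ.* 2 ℕ.+ y ℕ.* 2 ≡ (x ℕ.+ y) ℕ.* 2
    e+e = ℕ-Solver.solve-∀
    e+e+e : ∀ x y z → x ℕ.* 2 ℕ.+ y ℕ.* 2 ℕ.+ z ℕ.* 2 ≡ (x ℕ.+ y ℕ.+ z) ℕ.* 2
    e+e+e = ℕ-Solver.solve-∀

  disc-even-odd : ∀ k a b → disc (suc (k ℕ.* 2)) (a ℕ.* 2) (suc (b ℕ.* 2)) ≡ box S₁ k a (suc b)
  disc-even-odd k a b = trans (disc≡box (suc (k ℕ.* 2)) (a ℕ.* 2) (suc (b ℕ.* 2))) (cong₂ _-_
    (cong₂ _-_ (S₂-at-double (k ℕ.+ suc b ℕ.+ a) (o+o+e k b a)) (S₂-at-double (k ℕ.+ suc b) (o+o k b)))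
    (cong₂ _-_ (S₂-at-double+1 (k ℕ.+ a) (o+e k a)) (S₂-double+1 k)))
    where
    o+o : ∀ x y → suc (x ℕ.* 2) ℕ.+ suc (y ℕ.* 2) ≡ (x ℕ.+ suc y) ℕ.* 2
    o+o = ℕ-Solver.solve-∀
    o+e : ∀ x y → suc (x ℕ.* 2) ℕ.+ y ℕ.* 2 ≡ suc ((x ℕ.+ y) ℕ.* 2)
    o+e = ℕ-Solver.solve-∀
    o+o+e : ∀ x y z → suc (x ℕ.* 2) ℕ.+ suc (y ℕ.* 2) ℕ.+ z ℕ.* 2 ≡ (x ℕ.+ suc y ℕ.+ z) ℕ.* 2
    o+o+e = ℕ-Solver.solve-∀

  disc-odd-even : ∀ k a b → disc (suc (k ℕ.* 2)) (suc (a ℕ.* 2)) (b ℕ.* 2) ≡ box S₁ k (suc a) b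
  disc-odd-even k a b = begin
    disc i (suc (a ℕ.* 2)) (b ℕ.* 2)    ≡⟨ disc≡box i (suc (a ℕ.* 2)) (b ℕ.* 2) ⟩
    box S₂ i (suc (a ℕ.* 2)) (b ℕ.* 2)  ≡⟨ box-comm S₂ i (suc (a ℕ.* 2)) (b ℕ.* 2) ⟩
    box S₂ i (b ℕ.* 2) (suc (a ℕ.* 2))  ≡⟨ disc≡box i (b ℕ.* 2) (suc (a ℕ.* 2)) ⟨
    disc i (b ℕ.* 2) (suc (a ℕ.* 2))    ≡⟨ disc-even-odd k b a ⟩
    box S₁ k b (suc a)                  ≡⟨ box-comm S₁ k b (suc a) ⟩
    box S₁ k (suc a) b                  ∎
    where
    i = suc (k ℕ.* 2)

  disc-odd-odd≢0 : ∀ i a b → disc i (suc (a ℕ.* 2)) (suc (b ℕ.* 2)) ≢ 0ℤ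
  disc-odd-odd≢0 i a b disc≡0 = ℕ.even≢odd (ones i m n) (a ℕ.* b ℕ.* 2 ℕ.+ a ℕ.+ b) (begin
    2 ℕ.* ones i m n
      ≡⟨ +-injective (i-j≡0⇒i≡j (+ (2 ℕ.* ones i m n)) (+ (m ℕ.* n)) disc≡0) ⟩
    m ℕ.* n
      ≡⟨ o*o a b ⟩
    suc (2 ℕ.* (a ℕ.* b ℕ.* 2 ℕ.+ a ℕ.+ b))
      ∎)
    where
    m = suc (a ℕ.* 2)
    n = suc (b ℕ.* 2)
    o*o : ∀ x y → suc (x ℕ.* 2) ℕ.* suc (y ℕ.* 2) ≡ suc (2 ℕ.* (x ℕ.* y ℕ.* 2 ℕ.+ x ℕ.+ y))
    o*o = ℕ-Solver.solve-∀

  ∃box-S₁≢0 : ∀ a b → ∃[ i ] disc i a b ≢ 0ℤ → ∃[ k ] box S₁ k a b ≢ 0ℤ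
  ∃box-S₁≢0 a b (i , disc≢0) =
    let (j , varies) = disc-varies i a b disc≢0
        (k , step)   = ≢⇒∃-step _≟_ (λ x → disc x a b) j i varies
    in k , λ box≡0 → step (i-j≡0⇒i≡j _ _ (trans (disc-step k a b) box≡0))

  private
    1+x<[1+x]*2 : ∀ x → suc x < suc x ℕ.* 2
    1+x<[1+x]*2 x = s≤s (s≤s (ℕ.m≤m*n x 2))

  ∃disc≢0 : ∀ m n → Acc _<_ (m ℕ.+ n) → 1 ≤ m → 1 ≤ n → ∃[ i ] disc i m n ≢ 0ℤ
  ∃disc≢0 m n (acc rec) 1≤m 1≤n with evenOdd m | evenOdd n
  ∃disc≢0 _ _ _ () _ | even zero | _
  ∃disc≢0 _ _ _ _ () | _         | even zero
  ... | odd a        | odd b        = 0 , disc-odd-odd≢0 0 a b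
  ... | even (suc a) | even (suc b) =
    let (k , box≢0) = ∃box-S₁≢0 (suc a) (suc b) (∃disc≢0 (suc a) (suc b) (rec smaller) z<s z<s)
    in k ℕ.* 2 , box≢0 ∘ trans (sym (disc-even-even k (suc a) (suc b)))
    where smaller = ℕ.+-mono-<-≤ (1+x<[1+x]*2 a) (ℕ.m≤m*n (suc b) 2)
  ... | even (suc a) | odd b        =
    let (k , box≢0) = ∃box-S₁≢0 (suc a) (suc b) (∃disc≢0 (suc a) (suc b) (rec smaller) z<s z<s)
    in suc (k ℕ.* 2) , box≢0 ∘ trans (sym (disc-even-odd k (suc a) b))
    where smaller = ℕ.+-mono-<-≤ (1+x<[1+x]*2 a) (s≤s (ℕ.m≤m*n b 2))
  ... | odd a        | even (suc b) =
    let (k , box≢0) = ∃box-S₁≢0 (suc a) (suc b) (∃disc≢0 (suc a) (suc b) (rec smaller) z<s z<s)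
    in suc (k ℕ.* 2) , box≢0 ∘ trans (sym (disc-odd-even k a (suc b)))
    where smaller = ℕ.+-mono-≤-< (s≤s (ℕ.m≤m*n a 2)) (1+x<[1+x]*2 b)

  ones-nonconstant : ∀ {m n} → 1 ≤ m → 1 ≤ n → ∃[ i ] ∃[ j ] ones i m n ≢ ones j m n
  ones-nonconstant {m} {n} 1≤m 1≤n =
    let (i , disc≢0) = ∃disc≢0 m n (ℕ.<-wellFounded (m ℕ.+ n)) 1≤m 1≤n
        (j , varies) = disc-varies i m n disc≢0
    in j , i , varies ∘ cong (λ o → + (2 ℕ.* o) - + (m ℕ.* n))

module Balance where

  open ThueMorse
  open Discrepancy using (∣disc∣≤4)
  open import Data.Nat
  open import Data.Nat.Properties
  open import Data.Nat.DivMod using (m≡m%n+[m/n]*n; m%n<n)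
  import Data.Nat.Tactic.RingSolver as ℕ-Solver
  import Data.Integer.Base as ℤ
  import Data.Integer.Properties as ℤ
  open import Data.Bool using (true; false; if_then_else_; _xor_)
  open import Data.List using (upTo)
  open import Data.List.Extrema.Nat using (argmax; argmin; f[xs]≤f[argmax]; f[argmin]≤f[xs])
  open import Data.List.Membership.Propositional.Properties using (∈-upTo⁺)
  import Data.List.Relation.Unary.All as All
  open import Function using (_∘_)
  open import Relation.Binary.PropositionalEquality
  open ≡-Reasoning

  Σ<-cong : ∀ m {f g : ℕ → ℕ} → (∀ {k} → k < m → f k ≡ g k) → Σ< m f ≡ Σ< m g
  Σ<-cong zero    _   = refl
  Σ<-cong (suc m) f≡g = cong₂ _+_ (Σ<-cong m (f≡g ∘ m<n⇒m<1+n)) (f≡g ≤-refl)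

  tm-pair-early : ∀ q → ∃[ q′ ] q′ < 6 × tm q′ ≡ tm q × tm (suc q′) ≡ tm (suc q)
  tm-pair-early q with tm q | tm (suc q)
  ... | false | true  = 0 , s≤s z≤n , refl , refl
  ... | true  | true  = 1 , s≤s (s≤s z≤n) , refl , refl
  ... | true  | false = 2 , s≤s (s≤s (s≤s z≤n)) , refl , refl
  ... | false | false = 5 , ≤-refl , refl , refl

  tm-two-blocks : ∀ K {q q′} → tm q ≡ tm q′ → tm (suc q) ≡ tm (suc q′) →
                  ∀ {y} → y < 2 ^ K + 2 ^ K → tm (q * 2 ^ K + y) ≡ tm (q′ * 2 ^ K + y)
  tm-two-blocks K {q} {q′} tmq≡ _ {y} _ with y <? 2 ^ K
  ... | yes y<2^K = begin
    tm (q * 2 ^ K + y)   ≡⟨ tm-concat K q y y<2^K ⟩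
    tm q xor tm y        ≡⟨ cong (_xor tm y) tmq≡ ⟩
    tm q′ xor tm y       ≡⟨ tm-concat K q′ y y<2^K ⟨
    tm (q′ * 2 ^ K + y)  ∎
  tm-two-blocks K {q} {q′} _ tm[1+q]≡ {y} y< | no y≮2^K = begin
    tm (q * a + y)         ≡⟨ cong tm (carry q) ⟩
    tm (suc q * a + y′)    ≡⟨ tm-concat K (suc q) y′ y′<a ⟩
    tm (suc q) xor tm y′   ≡⟨ cong (_xor tm y′) tm[1+q]≡ ⟩
    tm (suc q′) xor tm y′  ≡⟨ tm-concat K (suc q′) y′ y′<a ⟨
    tm (suc q′ * a + y′)   ≡⟨ cong tm (carry q′) ⟨
    tm (q′ * a + y)        ∎
    where
    a  = 2 ^ K
    y′ = y ∸ a
    a+y′≡y : a + y′ ≡ y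
    a+y′≡y = m+[n∸m]≡n (≮⇒≥ y≮2^K)
    y′<a : y′ < a
    y′<a = +-cancelˡ-< a y′ a (subst (_< a + a) (sym a+y′≡y) y<)
    carry : ∀ r → r * a + y ≡ suc r * a + y′
    carry r = begin
      r * a + y         ≡⟨ cong (r * a +_) a+y′≡y ⟨
      r * a + (a + y′)  ≡⟨ +-assoc (r * a) a y′ ⟨
      r * a + a + y′    ≡⟨ cong (_+ y′) (+-comm (r * a) a) ⟩
      suc r * a + y′    ∎

  ones-transplant : ∀ {m n K q q′ r} → m + n ≤ 2 ^ K → r < 2 ^ K →
                    tm q ≡ tm q′ → tm (suc q) ≡ tm (suc q′) →
                    ones (q * 2 ^ K + r) m n ≡ ones (q′ * 2 ^ K + r) m n
  ones-transplant {m} {n} {K} {q} {q′} {r} m+n≤2^K r<2^K tmq≡ tm[1+q]≡ =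
    Σ<-cong m λ {k} k<m → Σ<-cong n λ {l} l<n → begin
      t (q * a + r + k + l)       ≡⟨ cong t (reassoc (q * a) r k l) ⟩
      t (q * a + (r + (k + l)))   ≡⟨ cong (λ b → if b then 1 else 0) (same-cell k<m l<n) ⟩
      t (q′ * a + (r + (k + l)))  ≡⟨ cong t (reassoc (q′ * a) r k l) ⟨
      t (q′ * a + r + k + l)      ∎
    where
    a = 2 ^ K
    reassoc : ∀ x r k l → x + r + k + l ≡ x + (r + (k + l))
    reassoc = ℕ-Solver.solve-∀
    same-cell : ∀ {k l} → k < m → l < n → tm (q * a + (r + (k + l))) ≡ tm (q′ * a + (r + (k + l)))
    same-cell k<m l<n = tm-two-blocks K {q} {q′} tmq≡ tm[1+q]≡
      (+-mono-<-≤ r<2^K (≤-trans (<⇒≤ (+-mono-< k<m l<n)) m+n≤2^K))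

  ones-recurrent : ∀ m n i → ∃[ i′ ] i′ < 6 * 2 ^ (m + n) × ones i′ m n ≡ ones i m n
  ones-recurrent m n i =
    let (q′ , q′<6 , tmq′≡ , tm[1+q′]≡) = tm-pair-early q in
    q′ * a + r , early q′<6 , (begin
      ones (q′ * a + r) m n  ≡⟨ ones-transplant {m} {n} {m + n} {q′} {q} m+n≤a r<a tmq′≡ tm[1+q′]≡ ⟩
      ones (q * a + r) m n   ≡⟨ cong (λ x → ones x m n) i≡q*a+r ⟨
      ones i m n             ∎)
    where
    a = 2 ^ (m + n)
    instance
      a≢0 : NonZero a
      a≢0 = m^n≢0 2 (m + n)
    q = i / a
    r = i % a
    m+n≤a : m + n ≤ a
    m+n≤a = <⇒≤ (n<2^n (m + n))
    r<a : r < a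
    r<a = m%n<n i a
    i≡q*a+r : i ≡ q * a + r
    i≡q*a+r = trans (m≡m%n+[m/n]*n i a) (+-comm r (q * a))
    early : ∀ {q′} → q′ < 6 → q′ * a + r < 6 * a
    early {q′} q′<6 = <-≤-trans (+-monoʳ-< (q′ * a) r<a)
                                (subst (_≤ 6 * a) (+-comm a (q′ * a)) (*-monoˡ-≤ a q′<6))

  module _ (g : ℕ → ℕ) {B} (attained-below : ∀ i → ∃[ i′ ] i′ < B × g i′ ≡ g i) where

    max-exists : ∃[ a ] ∀ i → g i ≤ g a
    max-exists = a , λ i →
      let (i′ , i′<B , gi′≡gi) = attained-below i in
      subst (_≤ g a) gi′≡gi (All.lookup (f[xs]≤f[argmax] {f = g} 0 (upTo B)) (∈-upTo⁺ i′<B))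
      where a = argmax g 0 (upTo B)

    min-exists : ∃[ b ] ∀ i → g b ≤ g i
    min-exists = b , λ i →
      let (i′ , i′<B , gi′≡gi) = attained-below i in
      subst (g b ≤_) gi′≡gi (All.lookup (f[argmin]≤f[xs] {f = g} 0 (upTo B)) (∈-upTo⁺ i′<B))
      where b = argmin g 0 (upTo B)

  ∣x-y∣≤u∸l : ∀ {l u x y} → l ≤ x → x ≤ u → l ≤ y → y ≤ u → ∣ x - y ∣ ≤ u ∸ l
  ∣x-y∣≤u∸l {x = x} {y} l≤x x≤u l≤y y≤u with ≤-total x y
  ... | inj₁ x≤y = subst (_≤ _) (sym (m≤n⇒∣m-n∣≡n∸m x≤y)) (∸-mono y≤u l≤x)
  ... | inj₂ y≤x = subst (_≤ _) (sym (m≤n⇒∣n-m∣≡n∸m y≤x)) (∸-mono x≤u l≤y)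

  balance-exists : ∀ m n → ∃[ β ] IsBalance m n β
  balance-exists m n =
    let (a , ≤max) = max-exists g (ones-recurrent m n)
        (b , min≤) = min-exists g (ones-recurrent m n)
    in g a ∸ g b
     , (λ i j → ∣x-y∣≤u∸l (min≤ i) (≤max i) (min≤ j) (≤max j))
     , a , b , m≤n⇒∣n-m∣≡n∸m (min≤ a)
    where
    g : ℕ → ℕ
    g i = ones i m n

  balance-positive : ∀ {m n β} → IsBalance m n β → ∃[ i ] ∃[ j ] ones i m n ≢ ones j m n → 1 ≤ β
  balance-positive (∣-∣≤β , _) (i , j , ones≢) =
    ≤-trans (n≢0⇒n>0 (ones≢ ∘ ∣m-n∣≡0⇒m≡n)) (∣-∣≤β i j)

  ∣+m-+n∣≡∣m-n∣ : ∀ m n → ℤ.∣ ℤ.+ m ℤ.- ℤ.+ n ∣ ≡ ∣ m - n ∣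
  ∣+m-+n∣≡∣m-n∣ m n with ≤-total m n
  ... | inj₁ m≤n = begin
    ℤ.∣ ℤ.+ m ℤ.- ℤ.+ n ∣  ≡⟨ cong ℤ.∣_∣ (ℤ.m-n≡m⊖n m n) ⟩
    ℤ.∣ m ℤ.⊖ n ∣          ≡⟨ ℤ.∣⊖∣-≤ m≤n ⟩
    n ∸ m                  ≡⟨ m≤n⇒∣m-n∣≡n∸m m≤n ⟨
    ∣ m - n ∣              ∎
  ... | inj₂ n≤m = begin
    ℤ.∣ ℤ.+ m ℤ.- ℤ.+ n ∣  ≡⟨ cong ℤ.∣_∣ (ℤ.m-n≡m⊖n m n) ⟩
    ℤ.∣ m ℤ.⊖ n ∣          ≡⟨ ℤ.∣m⊖n∣≡∣n⊖m∣ m n ⟩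
    ℤ.∣ n ℤ.⊖ m ∣          ≡⟨ ℤ.∣⊖∣-≤ n≤m ⟩
    m ∸ n                  ≡⟨ m≤n⇒∣n-m∣≡n∸m n≤m ⟨
    ∣ m - n ∣              ∎

  balance≤4 : ∀ {m n β} → IsBalance m n β → β ≤ 4
  balance≤4 {m} {n} {β} (_ , i , j , ∣oᵢ-oⱼ∣≡β) = *-cancelˡ-≤ 2 (subst (_≤ 8) ∣2oᵢ-2oⱼ∣≡2β (≤-trans
    (∣-∣-triangle (2 * ones i m n) (m * n) (2 * ones j m n))
    (+-mono-≤ (∣2o-mn∣≤4 i) (subst (_≤ 4) (∣-∣-comm (2 * ones j m n) (m * n)) (∣2o-mn∣≤4 j)))))
    where
    ∣2oᵢ-2oⱼ∣≡2β : ∣ 2 * ones i m n - 2 * ones j m n ∣ ≡ 2 * β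
    ∣2oᵢ-2oⱼ∣≡2β = trans (sym (*-distribˡ-∣-∣ 2 (ones i m n) (ones j m n))) (cong (2 *_) ∣oᵢ-oⱼ∣≡β)
    ∣2o-mn∣≤4 : ∀ i → ∣ 2 * ones i m n - m * n ∣ ≤ 4
    ∣2o-mn∣≤4 i = subst (_≤ 4) (∣+m-+n∣≡∣m-n∣ (2 * ones i m n) (m * n)) (∣disc∣≤4 i m n)

open Discrepancy using (∣disc∣≤4; ∃disc-neg; ones-nonconstant)
open Balance using (balance-exists; balance-positive; balance≤4)

theorem11 :
    (∀ (i m n : ℕ) → m ≥ 1 → n ≥ 1 → ∣ disc i m n ∣ ≤ 4)
    × (∀ (m n : ℕ) (c : ℤ) → m ≥ 1 → n ≥ 1 →
         ∃[ i ] disc i m n ≡ c → ∃[ j ] disc j m n ≡ - c)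
    × (∀ (m n : ℕ) → m ≥ 1 → n ≥ 1 →
         IsBalance m n 1 ⊎ IsBalance m n 2 ⊎ IsBalance m n 3 ⊎ IsBalance m n 4)
theorem11 =
    (λ i m n _ _ → ∣disc∣≤4 i m n)
  , (λ m n c _ _ → ∃disc-neg m n c)
  , λ m n 1≤m 1≤n →
      let (β , balance) = balance-exists m n in
      one-to-four {IsBalance m n}
        (balance-positive {m} {n} balance (ones-nonconstant 1≤m 1≤n))
        (balance≤4 {m} {n} balance)
        balance
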